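{- Let $\mathcal{P}$ be a one-dimensional pattern with weights in which at least one weight is nonzero, and let $\mathbf{w}\in A^{\mathbb{Z}}$ be a bi-infinite word over a finite alphabet $A$ such that $a_{\mathbf{w}}(\mathcal{P})=1$. Then $\mathbf{w}$ is periodic, i.e. there exists an integer $p\ne0$ with $\mathbf{w}(i+p)=\mathbf{w}(i)$ for all $i\in\mathbb{Z}$.
   Context: A figure with weights in $\mathbb{Z}^n$ is a finite set $F^w=\{(u,g_u): u\in F, g_u\in\mathbb{Z}\}$ with $F\subset\mathbb{Z}^n$ finite. A pattern with weights is the set of all integer translates $\{(u+\tau,g_u)\}$ of a fixed figure with weights. For an alphabet $A=\{a_1,\dots,a_k\}$ and a figure with weights $F^w=\{(u_1,g_1),\dots,(u_l,g_l)\}$, the linear combination of $\mathbf{w}$ over $F^w$ is the formal linear polynomial $\sum_{i=1}^l g_i\,\mathbf{w}(u_i)\in\mathbb{Z}[a_1,\dots,a_k]$ (letters treated as variables). The abelian pattern complexity $a_{\mathbf{w}}(\mathcal{P})$ is the number of distinct such linear combinations over all figures $F^w\in\mathcal{P}$. Here $n=1$. -}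

module Defs where

open import Data.Nat using (ℕ)
open import Data.Integer using (ℤ; _+_; 0ℤ)
open import Data.Fin using (Fin; _≟_)
open import Data.List using (List; []; _∷_; map)
open import Data.List.Relation.Unary.Unique.Propositional using (Unique)
open import Data.Product using (_×_; _,_; proj₁)
open import Relation.Nullary using (yes; no)
open import Relation.Binary.PropositionalEquality using (_≡_; _≢_)
open import Data.Product using (Σ)

Word : ℕ → Set
Word k = ℤ → Fin k

-- A figure with weights: a finite list of (position, weight) pairs.
-- It is a *set* {(u, g_u) : u ∈ F}, so positions must be pairwise distinct
-- (imposed via IsFigure below).
WFigure : Set
WFigure = List (ℤ × ℤ)

IsFigure : WFigure → Set
IsFigure F = Unique (map proj₁ F)

translate : ℤ → WFigure → WFigure
translate τ F = map (λ { (u , g) → (u + τ , g) }) F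

-- Formal linear polynomial Σ g_i · w(u_i) ∈ ℤ[a_0,…,a_{k-1}] (homogeneous of degree 1),
-- represented by its coefficient vector: coefficient of a_j.
linComb : ∀ {k} → Word k → WFigure → Fin k → ℤ
linComb w [] j = 0ℤ
linComb w ((u , g) ∷ F) j with w u ≟ j
... | yes _ = g + linComb w F j
... | no  _ = linComb w F j

-- The pattern generated by F is {translate τ F : τ ∈ ℤ}.
-- a_w(P) = 1  ⇔  all figures of P give the same linear combination, i.e.
-- every translate gives the same polynomial as F itself.
AbelianComplexityOne : ∀ {k} → Word k → WFigure → Set
AbelianComplexityOne w F = ∀ (τ : ℤ) (j : _) → linComb w (translate τ F) j ≡ linComb w F j

Periodic : ∀ {k} → Word k → Set
Periodic w = Σ ℤ (λ p → (p ≢ 0ℤ) × (∀ i → w (i + p) ≡ w i))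

-- If every translate of the figure carries the same polynomial, two translates cannot read
-- different letters at exactly one nonzero-weight position: the coefficient of the letter read
-- there by the first translate would differ by that weight. Applied to the leftmost and the
-- rightmost nonzero-weight positions m ≤ M, this says that the factor of length L = M − m of w
-- at any place determines the letter right after it and the letter right before it. By the
-- pigeonhole principle two of the factors starting at 0, …, k ^ L coincide; sliding them in both
-- directions shows that the distance between their starting points is a period of w.
module Submission where

open import Defs
open import Data.Nat using (ℕ)
open import Data.Integer using (ℤ; 0ℤ)
open import Data.Product using (_×_; _,_; ∃-syntax)
open import Data.List.Membership.Propositional using (_∈_)
open import Relation.Binary.PropositionalEquality using (_≢_)

open import Data.Fin as Fin using (Fin; toℕ; fromℕ<; funToFin; finToFun)
import Data.Fin.Properties as Finₚ
open import Data.Integer as ℤ using (_+_; _-_; -_; +_; -[1+_]; 1ℤ; ∣_∣; _≤_)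
import Data.Integer.Properties as ℤₚ
open import Algebra.Properties.AbelianGroup ℤₚ.+-0-abelianGroup using (∙-cancelˡ; ∙-cancelʳ)
open import Data.Integer.Tactic.RingSolver using (solve-∀)
open import Data.List using (List; []; _∷_; _++_; map; filter)
open import Data.List.Properties using (map-++)
import Data.List.Extrema ℤₚ.≤-totalOrder as Extrema
open import Data.List.Membership.Propositional using (_∉_)
open import Data.List.Membership.Propositional.Properties
  using (∈-map⁺; ∈-map⁻; ∈-filter⁺; ∈-filter⁻; ∈-++⁺ˡ; ∈-++⁺ʳ; ∈-++⁻; ∈-∃++)
import Data.List.Relation.Unary.All as All
open import Data.List.Relation.Unary.AllPairs using (_∷_)
open import Data.List.Relation.Unary.Any using (here; there)
open import Data.List.Relation.Unary.Unique.Propositional using (Unique)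
open import Data.Nat as ℕ using (zero; suc)
import Data.Nat.Properties as ℕₚ
open import Data.Product using (Σ; proj₁; proj₂)
open import Data.Sum using ([_,_]′)
open import Function using (_∘_; id)
open import Relation.Nullary using (yes; no; ¬?; contradiction)
open import Relation.Unary using (Decidable)
open import Relation.Binary.PropositionalEquality
  using (_≡_; refl; sym; trans; cong; cong₂; subst; subst₂; _≗_; module ≡-Reasoning)
open ≡-Reasoning

monomial : ∀ {k} → ℤ → Fin k → Fin k → ℤ
monomial g a j with a Fin.≟ j
... | yes _ = g
... | no  _ = 0ℤ

monomial-0 : ∀ {k} (a j : Fin k) → monomial 0ℤ a j ≡ 0ℤ
monomial-0 a j with a Fin.≟ j
... | yes _ = refl
... | no  _ = refl

monomial-diag : ∀ {k} g (a : Fin k) → monomial g a a ≡ g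
monomial-diag g a with a Fin.≟ a
... | yes _   = refl
... | no  a≢a = contradiction refl a≢a

monomial-≢ : ∀ {k} g {a j : Fin k} → a ≢ j → monomial g a j ≡ 0ℤ
monomial-≢ g {a} {j} a≢j with a Fin.≟ j
... | yes a≡j = contradiction a≡j a≢j
... | no  _   = refl

monomial-injective : ∀ {k g} {a b : Fin k} → g ≢ 0ℤ → monomial g a ≗ monomial g b → a ≡ b
monomial-injective {g = g} {a} {b} g≢0 same with b Fin.≟ a
... | yes b≡a = sym b≡a
... | no  b≢a = contradiction (trans (sym (monomial-diag g a)) (trans (same a) (monomial-≢ g b≢a))) g≢0

module _ {k : ℕ} (w : Word k) where

  linComb-∷ : ∀ u g G j → linComb w ((u , g) ∷ G) j ≡ monomial g (w u) j + linComb w G j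
  linComb-∷ u g G j with w u Fin.≟ j
  ... | yes _ = refl
  ... | no  _ = sym (ℤₚ.+-identityˡ _)

  linComb-++ : ∀ G H j → linComb w (G ++ H) j ≡ linComb w G j + linComb w H j
  linComb-++ [] H j = sym (ℤₚ.+-identityˡ _)
  linComb-++ ((u , g) ∷ G) H j = begin
    linComb w ((u , g) ∷ G ++ H) j                             ≡⟨ linComb-∷ u g (G ++ H) j ⟩
    monomial g (w u) j + linComb w (G ++ H) j                  ≡⟨ cong (_+_ (monomial g (w u) j)) (linComb-++ G H j) ⟩
    monomial g (w u) j + (linComb w G j + linComb w H j)       ≡⟨ sym (ℤₚ.+-assoc (monomial g (w u) j) _ _) ⟩
    (monomial g (w u) j + linComb w G j) + linComb w H j       ≡⟨ cong (_+ linComb w H j) (sym (linComb-∷ u g G j)) ⟩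
    linComb w ((u , g) ∷ G) j + linComb w H j                  ∎

  linComb-translate-cong : ∀ τ₁ τ₂ G → (∀ {u g} → (u , g) ∈ G → g ≢ 0ℤ → w (u + τ₁) ≡ w (u + τ₂))
                         → linComb w (translate τ₁ G) ≗ linComb w (translate τ₂ G)
  linComb-translate-cong τ₁ τ₂ [] agree j = refl
  linComb-translate-cong τ₁ τ₂ ((u , g) ∷ G) agree j = begin
    linComb w (translate τ₁ ((u , g) ∷ G)) j                    ≡⟨ linComb-∷ (u + τ₁) g (translate τ₁ G) j ⟩
    monomial g (w (u + τ₁)) j + linComb w (translate τ₁ G) j   ≡⟨ cong₂ _+_ head tail ⟩
    monomial g (w (u + τ₂)) j + linComb w (translate τ₂ G) j   ≡⟨ sym (linComb-∷ (u + τ₂) g (translate τ₂ G) j) ⟩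
    linComb w (translate τ₂ ((u , g) ∷ G)) j                    ∎
    where
    head : monomial g (w (u + τ₁)) j ≡ monomial g (w (u + τ₂)) j
    head with g ℤ.≟ 0ℤ
    ... | yes refl = trans (monomial-0 _ j) (sym (monomial-0 _ j))
    ... | no  g≢0  = cong (λ a → monomial g a j) (agree (here refl) g≢0)
    tail : linComb w (translate τ₁ G) j ≡ linComb w (translate τ₂ G) j
    tail = linComb-translate-cong τ₁ τ₂ G (λ mem → agree (there mem)) j

  linComb-translate-split : ∀ τ A u g B j
    → linComb w (translate τ (A ++ (u , g) ∷ B)) j
      ≡ linComb w (translate τ A) j + (monomial g (w (u + τ)) j + linComb w (translate τ B) j)
  linComb-translate-split τ A u g B j = begin
    linComb w (translate τ (A ++ (u , g) ∷ B)) j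
      ≡⟨ cong (λ G → linComb w G j) (map-++ _ A ((u , g) ∷ B)) ⟩
    linComb w (translate τ A ++ translate τ ((u , g) ∷ B)) j
      ≡⟨ linComb-++ (translate τ A) _ j ⟩
    linComb w (translate τ A) j + linComb w (translate τ ((u , g) ∷ B)) j
      ≡⟨ cong (_+_ (linComb w (translate τ A) j)) (linComb-∷ (u + τ) g (translate τ B) j) ⟩
    linComb w (translate τ A) j + (monomial g (w (u + τ)) j + linComb w (translate τ B) j) ∎

  linComb-translate-≗⇒monomial-≗ : ∀ τ₁ τ₂ A u₀ g₀ B
    → (∀ {u g} → (u , g) ∈ A ++ B → g ≢ 0ℤ → w (u + τ₁) ≡ w (u + τ₂))
    → linComb w (translate τ₁ (A ++ (u₀ , g₀) ∷ B)) ≗ linComb w (translate τ₂ (A ++ (u₀ , g₀) ∷ B))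
    → monomial g₀ (w (u₀ + τ₁)) ≗ monomial g₀ (w (u₀ + τ₂))
  linComb-translate-≗⇒monomial-≗ τ₁ τ₂ A u₀ g₀ B agree same j =
    ∙-cancelʳ (lc τ₁ B) _ _ (∙-cancelˡ (lc τ₁ A) _ _ (begin
      lc τ₁ A + (m₁ + lc τ₁ B)    ≡⟨ sym (linComb-translate-split τ₁ A u₀ g₀ B j) ⟩
      lc τ₁ (A ++ (u₀ , g₀) ∷ B)  ≡⟨ same j ⟩
      lc τ₂ (A ++ (u₀ , g₀) ∷ B)  ≡⟨ linComb-translate-split τ₂ A u₀ g₀ B j ⟩
      lc τ₂ A + (m₂ + lc τ₂ B)    ≡⟨ cong₂ (λ x y → x + (m₂ + y)) (sym (agreeOn A ∈-++⁺ˡ)) (sym (agreeOn B (∈-++⁺ʳ A))) ⟩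
      lc τ₁ A + (m₂ + lc τ₁ B)    ∎))
    where
    lc : ℤ → WFigure → ℤ
    lc τ G = linComb w (translate τ G) j
    m₁ m₂ : ℤ
    m₁ = monomial g₀ (w (u₀ + τ₁)) j
    m₂ = monomial g₀ (w (u₀ + τ₂)) j
    agreeOn : ∀ G → (∀ {e} → e ∈ G → e ∈ A ++ B) → lc τ₁ G ≡ lc τ₂ G
    agreeOn G ⊆A++B = linComb-translate-cong τ₁ τ₂ G (λ mem → agree (⊆A++B mem)) j

∉-middle : ∀ {A : Set} (xs : List A) {y ys} → Unique (xs ++ y ∷ ys) → y ∉ xs ++ ys
∉-middle []       (y∉ys ∷ _)    y∈ys       = All.lookup y∉ys y∈ys refl
∉-middle (x ∷ xs) (x∉ ∷ _)      (here y≡x) = All.lookup x∉ (∈-++⁺ʳ xs (here refl)) (sym y≡x)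
∉-middle (x ∷ xs) (_ ∷ unique)  (there y∈) = ∉-middle xs unique y∈

∈-++-insert : ∀ {A : Set} (xs : List A) {y ys z} → z ∈ xs ++ ys → z ∈ xs ++ y ∷ ys
∈-++-insert xs z∈ = [ ∈-++⁺ˡ , ∈-++⁺ʳ xs ∘ there ]′ (∈-++⁻ xs z∈)

nonzero? : Decidable (λ (e : ℤ × ℤ) → proj₂ e ≢ 0ℤ)
nonzero? (_ , g) = ¬? (g ℤ.≟ 0ℤ)

support : WFigure → List ℤ
support F = map proj₁ (filter nonzero? F)

∈-support⁺ : ∀ {F u g} → (u , g) ∈ F → g ≢ 0ℤ → u ∈ support F
∈-support⁺ mem g≢0 = ∈-map⁺ proj₁ (∈-filter⁺ nonzero? mem g≢0)

∈-support⁻ : ∀ {F u} → u ∈ support F → ∃[ g ] ((u , g) ∈ F × g ≢ 0ℤ)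
∈-support⁻ u∈S with (_ , g) , mem , refl ← ∈-map⁻ proj₁ u∈S = g , ∈-filter⁻ nonzero? mem

module Rigidity {k : ℕ} (w : Word k) (F : WFigure) (isFigure : IsFigure F)
                (ac : AbelianComplexityOne w F) where

  determined : ∀ {u₀} → u₀ ∈ support F → ∀ τ₁ τ₂
             → (∀ {u} → u ∈ support F → u ≢ u₀ → w (u + τ₁) ≡ w (u + τ₂))
             → w (u₀ + τ₁) ≡ w (u₀ + τ₂)
  determined {u₀} u₀∈S τ₁ τ₂ agree
    with g₀ , mem , g₀≢0 ← ∈-support⁻ {F} u₀∈S
    with A , B , refl ← ∈-∃++ mem
    = monomial-injective g₀≢0
        (linComb-translate-≗⇒monomial-≗ w τ₁ τ₂ A u₀ g₀ B agreeOff (λ j → trans (ac τ₁ j) (sym (ac τ₂ j))))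
    where
    unique : Unique (map proj₁ A ++ u₀ ∷ map proj₁ B)
    unique = subst Unique (map-++ proj₁ A ((u₀ , g₀) ∷ B)) isFigure
    agreeOff : ∀ {u g} → (u , g) ∈ A ++ B → g ≢ 0ℤ → w (u + τ₁) ≡ w (u + τ₂)
    agreeOff {u} mem g≢0 = agree (∈-support⁺ (∈-++-insert A mem) g≢0) u≢u₀
      where
      u≢u₀ : u ≢ u₀
      u≢u₀ refl = ∉-middle (map proj₁ A) unique (subst (u ∈_) (map-++ proj₁ A B) (∈-map⁺ proj₁ mem))

suc-pred-induction : (P : ℤ → Set) → P 0ℤ → (∀ {i} → P i → P (ℤ.suc i)) → (∀ {i} → P i → P (ℤ.pred i))
                   → ∀ i → P i
suc-pred-induction P base up down (+ zero)      = base
suc-pred-induction P base up down (+ suc n)     = up (suc-pred-induction P base up down (+ n))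
suc-pred-induction P base up down -[1+ zero ]   = down base
suc-pred-induction P base up down -[1+ suc n ]  = down (suc-pred-induction P base up down -[1+ n ])

funToFin-injective : ∀ {m n} {f g : Fin m → Fin n} → funToFin f ≡ funToFin g → f ≗ g
funToFin-injective {f = f} {g} eq i =
  trans (sym (Finₚ.finToFun-funToFin f i))
        (trans (cong (λ c → finToFun c i) eq) (Finₚ.finToFun-funToFin g i))

module Window {k : ℕ} (w : Word k) (L : ℕ) where

  Agree : ℤ → ℤ → Set
  Agree a b = ∀ n → n ℕ.< L → w (a + + n) ≡ w (b + + n)

  factor : ℕ → Fin L → Fin k
  factor x i = w (+ x + + toℕ i)

  factors-repeat : ∃[ x ] ∃[ y ] (x ℕ.< y × Agree (+ x) (+ y))
  factors-repeat
    with i , j , i<j , eq ← Finₚ.pigeonhole (ℕₚ.n<1+n (k ℕ.^ L)) (λ i → funToFin (factor (toℕ i)))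
    = toℕ i , toℕ j , i<j , agree
    where
    agree : Agree (+ toℕ i) (+ toℕ j)
    agree n n<L = subst (λ m → w (+ toℕ i + + m) ≡ w (+ toℕ j + + m)) (Finₚ.toℕ-fromℕ< n<L)
                        (funToFin-injective eq (fromℕ< n<L))

  module _ (extendʳ : ∀ a b → Agree a b → w (a + + L) ≡ w (b + + L))
           (extendˡ : ∀ a b → Agree a b → w (a - 1ℤ) ≡ w (b - 1ℤ)) where

    Agree-suc : ∀ a b → Agree a b → Agree (ℤ.suc a) (ℤ.suc b)
    Agree-suc a b agree n n<L = subst₂ (λ x y → w x ≡ w y) (shift a (+ n)) (shift b (+ n)) next
      where
      shift : ∀ c x → c + (1ℤ + x) ≡ (1ℤ + c) + x
      shift = solve-∀
      next : w (a + + suc n) ≡ w (b + + suc n)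
      next with suc n ℕ.<? L
      ... | yes 1+n<L = agree (suc n) 1+n<L
      ... | no  1+n≮L rewrite ℕₚ.≤-antisym n<L (ℕₚ.≮⇒≥ 1+n≮L) = extendʳ a b agree

    Agree-pred : ∀ a b → Agree a b → Agree (ℤ.pred a) (ℤ.pred b)
    Agree-pred a b agree zero _ =
      subst₂ (λ x y → w x ≡ w y) (shift a) (shift b) (extendˡ a b agree)
      where
      shift : ∀ c → c - 1ℤ ≡ (- 1ℤ + c) + 0ℤ
      shift = solve-∀
    Agree-pred a b agree (suc n) 1+n<L =
      subst₂ (λ x y → w x ≡ w y) (shift a (+ n)) (shift b (+ n)) (agree n (ℕₚ.<-trans (ℕₚ.n<1+n n) 1+n<L))
      where
      shift : ∀ c x → c + x ≡ (- 1ℤ + c) + (1ℤ + x)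
      shift = solve-∀

    Agree-shift : ∀ a b → Agree a b → ∀ d → Agree (a + d) (b + d)
    Agree-shift a b agree = suc-pred-induction (λ d → Agree (a + d) (b + d)) base up down
      where
      base : Agree (a + 0ℤ) (b + 0ℤ)
      base = subst₂ Agree (sym (ℤₚ.+-identityʳ a)) (sym (ℤₚ.+-identityʳ b)) agree
      +-step : ∀ s c d → s + (c + d) ≡ c + (s + d)
      +-step = solve-∀
      up : ∀ {d} → Agree (a + d) (b + d) → Agree (a + ℤ.suc d) (b + ℤ.suc d)
      up {d} agree′ = subst₂ Agree (+-step 1ℤ a d) (+-step 1ℤ b d) (Agree-suc (a + d) (b + d) agree′)
      down : ∀ {d} → Agree (a + d) (b + d) → Agree (a + ℤ.pred d) (b + ℤ.pred d)
      down {d} agree′ = subst₂ Agree (+-step (- 1ℤ) a d) (+-step (- 1ℤ) b d) (Agree-pred (a + d) (b + d) agree′)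

    Agree⇒Periodic : ∀ a b → Agree a b → a ≢ b → Periodic w
    Agree⇒Periodic a b agree a≢b = b - a , (λ b-a≡0 → a≢b (sym (ℤₚ.i-j≡0⇒i≡j b a b-a≡0))) , period
      where
      back : ∀ a i l → (a + (i - a - l)) + l ≡ i
      back = solve-∀
      forth : ∀ a b i l → (b + (i - a - l)) + l ≡ i + (b - a)
      forth = solve-∀
      period : ∀ i → w (i + (b - a)) ≡ w i
      period i = sym (subst₂ (λ x y → w x ≡ w y) (back a i (+ L)) (forth a b i (+ L))
                             (extendʳ (a + d) (b + d) (Agree-shift a b agree d)))
        where d = i - a - + L

    periodic : Periodic w
    periodic with x , y , x<y , agree ← factors-repeat =
      Agree⇒Periodic (+ x) (+ y) agree (ℕₚ.<⇒≢ x<y ∘ ℤₚ.+-injective)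

i≤j⇒j≡i+∣j-i∣ : ∀ {i j} → i ≤ j → j ≡ i + + ∣ j - i ∣
i≤j⇒j≡i+∣j-i∣ {i} {j} i≤j = begin
  j               ≡⟨ j≡i+[j-i] i j ⟩
  i + (j - i)     ≡⟨ cong (_+_ i) (sym (ℤₚ.0≤i⇒+∣i∣≡i (ℤₚ.i≤j⇒0≤j-i i≤j))) ⟩
  i + + ∣ j - i ∣ ∎
  where
  j≡i+[j-i] : ∀ i j → j ≡ i + (j - i)
  j≡i+[j-i] = solve-∀

i≤j≤k⇒∣j-i∣≤∣k-i∣ : ∀ {i j k} → i ≤ j → j ≤ k → ∣ j - i ∣ ℕ.≤ ∣ k - i ∣
i≤j≤k⇒∣j-i∣≤∣k-i∣ {i} i≤j j≤k =
  ℤₚ.drop‿+≤+ (subst₂ _≤_ (sym (+∣-i∣ i≤j)) (sym (+∣-i∣ (ℤₚ.≤-trans i≤j j≤k))) (ℤₚ.+-monoˡ-≤ (- i) j≤k))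
  where
  +∣-i∣ : ∀ {j} → i ≤ j → + ∣ j - i ∣ ≡ j - i
  +∣-i∣ = ℤₚ.0≤i⇒+∣i∣≡i ∘ ℤₚ.i≤j⇒0≤j-i

module Span {k : ℕ} (w : Word k) (F : WFigure) (isFigure : IsFigure F) (ac : AbelianComplexityOne w F)
            {u* : ℤ} (u*∈S : u* ∈ support F) where

  open Rigidity w F isFigure ac

  S : List ℤ
  S = support F

  m M : ℤ
  m = Extrema.min u* S
  M = Extrema.max u* S

  m∈S : m ∈ S
  m∈S = [ (λ m≡u* → subst (_∈ S) (sym m≡u*) u*∈S) , id ]′ (Extrema.argmin-sel id u* S)

  M∈S : M ∈ S
  M∈S = [ (λ M≡u* → subst (_∈ S) (sym M≡u*) u*∈S) , id ]′ (Extrema.argmax-sel id u* S)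

  m≤support : ∀ {u} → u ∈ S → m ≤ u
  m≤support = All.lookup (Extrema.min≤xs u* S)

  support≤M : ∀ {u} → u ∈ S → u ≤ M
  support≤M = All.lookup (Extrema.xs≤max u* S)

  L : ℕ
  L = ∣ M - m ∣

  M≡m+L : M ≡ m + + L
  M≡m+L = i≤j⇒j≡i+∣j-i∣ (ℤₚ.≤-trans (m≤support u*∈S) (support≤M u*∈S))

  support-offset : ∀ {u} → u ∈ S → Σ ℕ λ n → u ≡ m + + n × n ℕ.≤ L
  support-offset {u} u∈S =
    ∣ u - m ∣ , i≤j⇒j≡i+∣j-i∣ (m≤support u∈S) , i≤j≤k⇒∣j-i∣≤∣k-i∣ (m≤support u∈S) (support≤M u∈S)

  translate-offset : ∀ {u x} → u ≡ m + x → ∀ c → u + (c - m) ≡ c + x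
  translate-offset {x = x} refl c = cancel m x c
    where
    cancel : ∀ m x c → (m + x) + (c - m) ≡ c + x
    cancel = solve-∀

  open Window w L using (Agree)

  extendʳ : ∀ a b → Agree a b → w (a + + L) ≡ w (b + + L)
  extendʳ a b agree =
    subst₂ (λ x y → w x ≡ w y) (translate-offset M≡m+L a) (translate-offset M≡m+L b)
           (determined M∈S (a - m) (b - m) below)
    where
    below : ∀ {u} → u ∈ S → u ≢ M → w (u + (a - m)) ≡ w (u + (b - m))
    below u∈S u≢M with n , u≡m+n , n≤L ← support-offset u∈S =
      subst₂ (λ x y → w x ≡ w y) (sym (translate-offset u≡m+n a)) (sym (translate-offset u≡m+n b))
             (agree n (ℕₚ.≤∧≢⇒< n≤L n≢L))
      where
      n≢L : n ≢ L
      n≢L n≡L = u≢M (trans u≡m+n (trans (cong (λ l → m + + l) n≡L) (sym M≡m+L)))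

  extendˡ : ∀ a b → Agree a b → w (a - 1ℤ) ≡ w (b - 1ℤ)
  extendˡ a b agree =
    subst₂ (λ x y → w x ≡ w y) (at-m a) (at-m b) (determined m∈S (a - 1ℤ - m) (b - 1ℤ - m) above)
    where
    at-m : ∀ c → m + (c - 1ℤ - m) ≡ c - 1ℤ
    at-m c = trans (translate-offset (sym (ℤₚ.+-identityʳ m)) (c - 1ℤ)) (ℤₚ.+-identityʳ (c - 1ℤ))
    unshift : ∀ c x → (c - 1ℤ) + (1ℤ + x) ≡ c + x
    unshift = solve-∀
    above : ∀ {u} → u ∈ S → u ≢ m → w (u + (a - 1ℤ - m)) ≡ w (u + (b - 1ℤ - m))
    above {u} u∈S u≢m with support-offset u∈S
    ... | zero  , u≡m+0   , _   = contradiction (trans u≡m+0 (ℤₚ.+-identityʳ m)) u≢m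
    ... | suc n , u≡m+1+n , n<L =
      subst₂ (λ x y → w x ≡ w y) (sym (position a)) (sym (position b)) (agree n n<L)
      where
      position : ∀ c → u + (c - 1ℤ - m) ≡ c + + n
      position c = trans (translate-offset u≡m+1+n (c - 1ℤ)) (unshift c (+ n))

corollary1 : (k : ℕ) (w : Word k) (F : WFigure) → IsFigure F
    → (∃[ u ] ∃[ g ] ((u , g) ∈ F × g ≢ 0ℤ))
    → AbelianComplexityOne w F
    → Periodic w
corollary1 k w F isFigure (u , g , mem , g≢0) ac = Window.periodic w L extendʳ extendˡ
  where open Span w F isFigure ac (∈-support⁺ mem g≢0)
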